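{- Let $n$ and $\sigma$ be integers with $2 \leq \sigma < \frac{n}{4}$. There is no deterministic algorithm that performs at most $\frac{(n-1)\sigma}{16}$ equality comparisons in the worst case and computes the $f$-factorisation of a length-$n$ string with at most $\sigma$ distinct symbols.
   Context: The input string over a general unordered alphabet is accessed only through queries "is $T[i]=T[j]$?", each counting as one equality comparison. The $f$-factorisation of $T$ is the unique factorisation $T=f_1f_2\cdots f_z$ in which each factor $f_i$ is either a single symbol that does not occur in $f_1\cdots f_{i-1}$, or is the longest fragment starting at that position such that $f_i$ occurs twice in $f_1\cdots f_i$. -}

module Defs where

open import Data.Nat using (ℕ; zero; suc; _+_; _*_; _≤_; _<_)
open import Data.Fin using (Fin)
open import Data.List using (List; []; _∷_; length; take; drop; tabulate)
open import Data.List.Membership.Propositional using (_∈_)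
open import Data.Product using (Σ; ∃; _×_)
open import Data.Sum using (_⊎_)
open import Relation.Nullary using (¬_)
open import Relation.Binary.PropositionalEquality using (_≡_)

-- Strings are accessed only through equality queries "T[i] = T[j]?".
-- A deterministic algorithm on inputs of length n is modelled as a
-- (binary) decision tree: an inner node asks "T[i] = T[j]?" and continues
-- in the left subtree on "yes" and the right subtree on "no"; a leaf
-- returns the output, an f-factorisation given as the list of the lengths
-- |f_1|, |f_2|, ..., |f_z| of its factors.

data DTree (n : ℕ) : Set where
  leaf  : List ℕ → DTree n
  query : Fin n → Fin n → DTree n → DTree n → DTree n

-- Symbols are drawn from ℕ (an arbitrary type with decidable equality
-- would do equally well: the tree only observes equalities).
Str : ℕ → Set
Str n = Fin n → ℕ

run : ∀ {n} → DTree n → Str n → List ℕ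
run (leaf o) T = o
run (query i j yes no) T with T i Data.Nat.≟ T j
... | Relation.Nullary.yes _ = run yes T
... | Relation.Nullary.no  _ = run no T

cost : ∀ {n} → DTree n → Str n → ℕ
cost (leaf o) T = zero
cost (query i j yes no) T with T i Data.Nat.≟ T j
... | Relation.Nullary.yes _ = suc (cost yes T)
... | Relation.Nullary.no  _ = suc (cost no T)

AtMostDistinct : ∀ {n} → ℕ → Str n → Set
AtMostDistinct {n} σ T = Σ (List ℕ) λ S → length S ≤ σ × (∀ i → T i ∈ S)

toList : ∀ {n} → Str n → List ℕ
toList T = tabulate T

NewSymbol : List ℕ → ℕ → Set
NewSymbol w p = Σ ℕ λ x → Σ (List ℕ) λ rest →
  (drop p w ≡ x ∷ rest) × ¬ (x ∈ take p w)

-- the fragment w[p..p+ℓ) (ℓ ≥ 1) occurs twice in w[0..p+ℓ), i.e. it also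
-- occurs at some start q < p
OccursTwice : List ℕ → ℕ → ℕ → Set
OccursTwice w p ℓ = (1 ≤ ℓ) × (p + ℓ ≤ length w) ×
  (Σ ℕ λ q → (q < p) × (take ℓ (drop q w) ≡ take ℓ (drop p w)))

IsFactor : List ℕ → ℕ → ℕ → Set
IsFactor w p ℓ =
  ((ℓ ≡ 1) × NewSymbol w p)
  ⊎ (OccursTwice w p ℓ × (∀ ℓ' → OccursTwice w p ℓ' → ℓ' ≤ ℓ))

FFactFrom : List ℕ → ℕ → List ℕ → Set
FFactFrom w p []       = p ≡ length w
FFactFrom w p (ℓ ∷ ls) = IsFactor w p ℓ × FFactFrom w (p + ℓ) ls

IsFFactorisation : List ℕ → List ℕ → Set
IsFFactorisation w ls = FFactFrom w zero ls

-- Adversary argument. The input consists of ⌊n/2⌋ blocks of two equal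
-- symbols, so comparisons are in effect comparisons of blocks. Blocks
-- x < σ - 1 are fixed to the symbol x; a "free" block stays open, and every
-- comparison involving it is answered "different", until it has been compared
-- σ - 2 times; it is then committed to one of the symbols 0, …, σ - 2 that
-- differs from the symbols of all its partners. If the algorithm stops while
-- some free block p is still open, committing the other open blocks yields a
-- string consistent with every answer in which block p repeats the earlier
-- block holding its symbol, so no factor of length 1 starts at 2p; giving p
-- the unused symbol σ - 1 instead yields another consistent string in which
-- such a factor does start at 2p. The algorithm answers both alike, so it errs
-- on one of them. Otherwise each of the ⌊n/2⌋ - σ + 1 free blocks took part in
-- at least σ - 1 comparisons, so at least (σ - 1)(⌊n/2⌋ - σ + 1)/2 comparisons
-- were made, which is more than (n - 1)σ/16 when 4σ < n.

module Submission where

open import Defs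
open import Data.Nat
open import Data.Nat.Properties
open import Data.Nat.DivMod using (_%_; m%n<n; m<n⇒m%n≡m)
open import Data.Nat.ListAction using (sum)
open import Data.Nat.Tactic.RingSolver using (solve-∀)
open import Data.Bool using (Bool; true; false; not; _∧_; if_then_else_)
open import Data.Bool.Properties using (¬-not) renaming (_≟_ to _≟ᵇ_)
open import Data.Fin using (Fin; toℕ)
open import Data.List using (List; []; _∷_; length; take; drop; tabulate; map; filter; _++_; applyUpTo; upTo)
open import Data.List.Properties
  using (drop-drop; drop-[]; ∷-injective; length-tabulate; length-++; length-map; length-applyUpTo;
         length-upTo; filter-notAll; map-cong)
open import Data.List.Membership.Propositional using (_∈_; _∉_; find)
open import Data.List.Membership.DecPropositional _≟_ using (_∈?_)
open import Data.List.Membership.Propositional.Properties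
  using (∈-filter⁺; ∈-++⁺ˡ; ∈-++⁺ʳ; ∈-map⁺; ∈-applyUpTo⁺; ∈-applyUpTo⁻; ∈-upTo⁺)
open import Data.List.Relation.Binary.Subset.Propositional using (_⊆_)
open import Data.List.Relation.Unary.All as All using (All; []; _∷_; all?)
open import Data.List.Relation.Unary.All.Properties using (anti-mono; ¬All⇒Any¬)
open import Data.List.Relation.Unary.Any as Any using (here; there)
open import Data.List.Relation.Unary.Unique.Propositional using (Unique; []; _∷_)
open import Data.List.Relation.Unary.Unique.Propositional.Properties using (applyUpTo⁺₁)
open import Data.Product using (Σ; ∃₂; _×_; _,_; proj₁; proj₂; map₂)
open import Data.Sum using (_⊎_; inj₁; inj₂)
open import Data.Empty using (⊥; ⊥-elim)
open import Function using (_∘_; id; case_of_)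
open import Relation.Nullary using (¬_; Dec; yes; no; ¬?; contradiction)
open import Relation.Nullary.Decidable using (_×-dec_; isYes)
open import Relation.Binary.PropositionalEquality
open import Algebra.Properties.CommutativeSemigroup +-commutativeSemigroup using (interchange)

-- Occurrences and factors

drop-nonempty : ∀ (w : List ℕ) {i} → i < length w → ∃₂ λ x r → drop i w ≡ x ∷ r
drop-nonempty (x ∷ w) {zero}  _         = x , w , refl
drop-nonempty (x ∷ w) {suc i} (s≤s i<n) = drop-nonempty w i<n

drop-nonempty⇒< : ∀ (w : List ℕ) i {x r} → drop i w ≡ x ∷ r → i < length w
drop-nonempty⇒< (y ∷ w) zero    _  = s≤s z≤n
drop-nonempty⇒< (y ∷ w) (suc i) eq = s≤s (drop-nonempty⇒< w i eq)
drop-nonempty⇒< []      zero    ()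
drop-nonempty⇒< []      (suc i) ()

drop-∈-take : ∀ (w : List ℕ) {j i x r} → j < i → drop j w ≡ x ∷ r → x ∈ take i w
drop-∈-take (y ∷ w) {zero}  {suc i} _         refl = here refl
drop-∈-take (y ∷ w) {suc j} {suc i} (s≤s j<i) eq   = there (drop-∈-take w j<i eq)

take-≡⇒drop-head-≡ : ∀ (u v : List ℕ) {ℓ k x y r s} → take ℓ u ≡ take ℓ v → k < ℓ →
  drop k u ≡ x ∷ r → drop k v ≡ y ∷ s → x ≡ y
take-≡⇒drop-head-≡ (a ∷ u) (b ∷ v) {suc ℓ} {zero}  eq _         refl refl = proj₁ (∷-injective eq)
take-≡⇒drop-head-≡ (a ∷ u) (b ∷ v) {suc ℓ} {suc k} eq (s≤s k<ℓ) eu   ev   =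
  take-≡⇒drop-head-≡ u v (proj₂ (∷-injective eq)) k<ℓ eu ev
take-≡⇒drop-head-≡ [] v {k = k} _ _ eu _ with () ← trans (sym (drop-[] k)) eu
take-≡⇒drop-head-≡ (a ∷ u) [] {k = k} _ _ _ ev with () ← trans (sym (drop-[] k)) ev

occursTwice⇒copied : ∀ w {p ℓ i x r} → OccursTwice w p ℓ → p ≤ i → i < p + ℓ →
  drop i w ≡ x ∷ r → x ∈ take i w
occursTwice⇒copied w {p} {ℓ} {i} {x} (_ , p+ℓ≤∣w∣ , q , q<p , same) p≤i i<p+ℓ wᵢ≡x =
  let y , r′ , wⱼ≡y = drop-nonempty w (<-≤-trans (<-trans j<i i<p+ℓ) p+ℓ≤∣w∣)
      y≡x = take-≡⇒drop-head-≡ (drop q w) (drop p w) same k<ℓ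
              (trans (drop-drop q k w) wⱼ≡y)
              (trans (drop-drop p k w) (subst (λ z → drop z w ≡ x ∷ _) (sym p+k≡i) wᵢ≡x))
  in drop-∈-take w j<i (subst (λ z → drop (q + k) w ≡ z ∷ r′) y≡x wⱼ≡y)
  where
  k = i ∸ p
  p+k≡i : p + k ≡ i
  p+k≡i = m+[n∸m]≡n p≤i
  k<ℓ : k < ℓ
  k<ℓ = +-cancelˡ-< p k ℓ (subst (_< p + ℓ) (sym p+k≡i) i<p+ℓ)
  j<i : q + k < i
  j<i = subst (q + k <_) p+k≡i (+-monoˡ-< k q<p)

data FactorAt : ℕ → List ℕ → ℕ → ℕ → Set where
  here  : ∀ {p ℓ ls} → FactorAt p (ℓ ∷ ls) p ℓ
  there : ∀ {p ℓ ls i ℓ′} → FactorAt (p + ℓ) ls i ℓ′ → FactorAt p (ℓ ∷ ls) i ℓ′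

factorAt⇒isFactor : ∀ {w p ls i ℓ} → FFactFrom w p ls → FactorAt p ls i ℓ → IsFactor w i ℓ
factorAt⇒isFactor (fac , _)    here        = fac
factorAt⇒isFactor (_   , rest) (there at) = factorAt⇒isFactor rest at

newSymbol⇒unitFactorAt : ∀ w {i} → NewSymbol w i →
  ∀ {p} ls → FFactFrom w p ls → p ≤ i → FactorAt p ls i 1
newSymbol⇒unitFactorAt w {i} (_ , _ , wᵢ≡x , new) [] p≡∣w∣ p≤i =
  ⊥-elim (<-irrefl p≡∣w∣ (≤-<-trans p≤i (drop-nonempty⇒< w i wᵢ≡x)))
newSymbol⇒unitFactorAt w {i} newᵢ@(_ , _ , wᵢ≡x , new) {p} (ℓ ∷ ls) (fac , rest) p≤i
  with i <? p + ℓ | fac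
... | no i≮p+ℓ | _ = there (newSymbol⇒unitFactorAt w newᵢ ls rest (≮⇒≥ i≮p+ℓ))
... | yes i<p+ℓ | inj₂ (occ , _) = ⊥-elim (new (occursTwice⇒copied w occ p≤i i<p+ℓ wᵢ≡x))
... | yes i<p+1 | inj₁ (refl , _)
  with refl ← ≤-antisym p≤i (m<1+n⇒m≤n (subst (i <_) (+-comm p 1) i<p+1)) = here

unitFactor-¬occursTwice : ∀ {w i} → IsFactor w i 1 → ¬ OccursTwice w i 2
unitFactor-¬occursTwice {w} {i} (inj₁ (_ , _ , _ , wᵢ≡x , new)) occ =
  new (occursTwice⇒copied w occ ≤-refl (m<m+n i (s≤s z≤n)) wᵢ≡x)
unitFactor-¬occursTwice (inj₂ (_ , longest)) occ with s≤s () ← longest 2 occ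

fFactorisation-detects-repeat : ∀ {w₀ w₁ i ls} → OccursTwice w₀ i 2 → NewSymbol w₁ i →
  IsFFactorisation w₀ ls → IsFFactorisation w₁ ls → ⊥
fFactorisation-detects-repeat {w₁ = w₁} {ls = ls} occ new f₀ f₁ =
  unitFactor-¬occursTwice (factorAt⇒isFactor f₀ (newSymbol⇒unitFactorAt w₁ new ls f₁ z≤n)) occ

-- Strings of blocks

tabulateℕ : ℕ → (ℕ → ℕ) → List ℕ
tabulateℕ n G = tabulate {n = n} (G ∘ toℕ)

length-tabulateℕ : ∀ n G → length (tabulateℕ n G) ≡ n
length-tabulateℕ n G = length-tabulate (G ∘ toℕ)

drop-tabulateℕ : ∀ n G {j} → j < n → drop j (tabulateℕ n G) ≡ G j ∷ drop (suc j) (tabulateℕ n G)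
drop-tabulateℕ (suc n) G {zero}  _         = refl
drop-tabulateℕ (suc n) G {suc j} (s≤s j<n) = drop-tabulateℕ n (G ∘ suc) j<n

∈-take-tabulateℕ : ∀ n G {i x} → x ∈ take i (tabulateℕ n G) → Σ ℕ λ j → j < i × x ≡ G j
∈-take-tabulateℕ (suc n) G {suc i} (here x≡G0) = zero , s≤s z≤n , x≡G0
∈-take-tabulateℕ (suc n) G {suc i} (there x∈) =
  let j , j<i , x≡Gj = ∈-take-tabulateℕ n (G ∘ suc) x∈ in suc j , s≤s j<i , x≡Gj

newSymbol-tabulateℕ : ∀ n G {i} → i < n → (∀ j → j < i → G j ≢ G i) → NewSymbol (tabulateℕ n G) i
newSymbol-tabulateℕ n G i<n fresh = G _ , _ , drop-tabulateℕ n G i<n , λ Gᵢ∈ →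
  let j , j<i , Gᵢ≡Gⱼ = ∈-take-tabulateℕ n G Gᵢ∈ in fresh j j<i (sym Gᵢ≡Gⱼ)

occursTwice-tabulateℕ : ∀ n G {q i} → q < i → i + 2 ≤ n →
  G q ≡ G i → G (suc q) ≡ G (suc i) → OccursTwice (tabulateℕ n G) i 2
occursTwice-tabulateℕ n G {q} {i} q<i i+2≤n Gq≡Gi Gq′≡Gi′ =
  s≤s z≤n , subst (i + 2 ≤_) (sym (length-tabulateℕ n G)) i+2≤n , q , q<i , (begin
    take 2 (drop q (tabulateℕ n G))  ≡⟨ pair q (<-trans (s≤s q<i) i+1<n) ⟩
    G q ∷ G (suc q) ∷ []             ≡⟨ cong₂ (λ a b → a ∷ b ∷ []) Gq≡Gi Gq′≡Gi′ ⟩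
    G i ∷ G (suc i) ∷ []             ≡⟨ pair i i+1<n ⟨
    take 2 (drop i (tabulateℕ n G))  ∎)
  where
  open ≡-Reasoning
  i+1<n : suc i < n
  i+1<n = subst (_≤ n) (+-comm i 2) i+2≤n
  pair : ∀ j → suc j < n → take 2 (drop j (tabulateℕ n G)) ≡ G j ∷ G (suc j) ∷ []
  pair j j+1<n rewrite drop-tabulateℕ n G (<-trans (n<1+n j) j+1<n)
                     | drop-tabulateℕ n G j+1<n = refl

⌊1+n+n/2⌋≡n : ∀ n → ⌊ suc (n + n) /2⌋ ≡ n
⌊1+n+n/2⌋≡n zero    = refl
⌊1+n+n/2⌋≡n (suc n) rewrite +-suc n n = cong suc (⌊1+n+n/2⌋≡n n)

⌊n+n/2⌋≡n : ∀ n → ⌊ n + n /2⌋ ≡ n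
⌊n+n/2⌋≡n n = sym (n≡⌊n+n/2⌋ n)

m<n+n⇒⌊m/2⌋<n : ∀ {m n} → m < n + n → ⌊ m /2⌋ < n
m<n+n⇒⌊m/2⌋<n {m} {n} m<n+n = subst (suc ⌊ m /2⌋ ≤_) (⌊1+n+n/2⌋≡n n) (⌊n/2⌋-mono (s≤s m<n+n))

⌊n/2⌋+⌊n/2⌋≤n : ∀ n → ⌊ n /2⌋ + ⌊ n /2⌋ ≤ n
⌊n/2⌋+⌊n/2⌋≤n n = ≤-trans (+-monoʳ-≤ ⌊ n /2⌋ (⌊n/2⌋≤⌈n/2⌉ n)) (≤-reflexive (⌊n/2⌋+⌈n/2⌉≡n n))

block-fits : ∀ {n x} → x < ⌊ n /2⌋ → x + x + 2 ≤ n
block-fits {n} {x} x<h = begin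
  x + x + 2          ≡⟨ trans (+-comm (x + x) 2) (cong suc (sym (+-suc x x))) ⟩
  suc x + suc x      ≤⟨ +-mono-≤ x<h x<h ⟩
  ⌊ n /2⌋ + ⌊ n /2⌋  ≤⟨ ⌊n/2⌋+⌊n/2⌋≤n n ⟩
  n                  ∎
  where open ≤-Reasoning

n≤1+⌊n/2⌋+⌊n/2⌋ : ∀ n → n ≤ suc (⌊ n /2⌋ + ⌊ n /2⌋)
n≤1+⌊n/2⌋+⌊n/2⌋ n = begin
  n                          ≡⟨ ⌊n/2⌋+⌈n/2⌉≡n n ⟨
  ⌊ n /2⌋ + ⌈ n /2⌉          ≤⟨ +-monoʳ-≤ ⌊ n /2⌋ (⌊n/2⌋-mono (n≤1+n (suc n))) ⟩
  ⌊ n /2⌋ + suc ⌊ n /2⌋      ≡⟨ +-suc ⌊ n /2⌋ ⌊ n /2⌋ ⟩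
  suc (⌊ n /2⌋ + ⌊ n /2⌋)    ∎
  where open ≤-Reasoning

-- Counting

≤+suc : ∀ {a b c d} → a ≤ b + c → b ≤ suc d → a ≤ d + suc c
≤+suc {b = b} {c} {d} a≤b+c b≤1+d =
  ≤-trans a≤b+c (subst (b + c ≤_) (sym (+-suc d c)) (+-monoˡ-≤ c b≤1+d))

private
  split-length : ∀ k b → 4 * (2 + k) + b ≡ (2 + 2 * k) + (6 + 2 * k + b)
  split-length = solve-∀

  exceeds-double : ∀ k b → 4 * (2 + k) + b ≡ suc (k + k) + (7 + 2 * k + b)
  exceeds-double = solve-∀

  split-halves : ∀ k u → (suc k + u) + (suc k + u) ≡ (2 + 2 * k) + 2 * u
  split-halves = solve-∀

  expand-product : ∀ k b → 4 * suc k * (6 + 2 * k + b) ≡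
    suc ((4 * (2 + k) + b) * (2 + k) + (7 + 16 * k + 4 * (k * k) + 2 * b + 3 * (k * b)))
  expand-product = solve-∀

  regroup : ∀ k u → 4 * suc k * (2 * u) ≡ 8 * (suc k * u)
  regroup = solve-∀

too-few-comparisons : ∀ n k c → 4 * (2 + k) < n →
  suc k * (⌊ n /2⌋ ∸ suc k) ≤ 2 * c → 16 * c ≤ (n ∸ 1) * (2 + k) → ⊥
too-few-comparisons n k c 4σ<n busy cheap with m≤n⇒∃[o]m+o≡n 4σ<n
... | b , refl = <-irrefl refl (<-≤-trans key cheap)
  where
  N = 4 * (2 + k) + b
  h = ⌊ suc N /2⌋
  N≤h+h : N ≤ h + h
  N≤h+h = ≤-pred (n≤1+⌊n/2⌋+⌊n/2⌋ (suc N))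
  m≤h : suc k ≤ h
  m≤h with suc k ≤? h
  ... | yes m≤h = m≤h
  ... | no  m≰h = let h≤k = ≤-pred (≰⇒> m≰h) in contradiction
        (≤-trans N≤h+h (+-mono-≤ h≤k h≤k)) (<⇒≱ (subst (k + k <_) (sym (exceeds-double k b)) (m≤m+n _ _)))
  u = h ∸ suc k
  slack : 6 + 2 * k + b ≤ 2 * u
  slack = +-cancelˡ-≤ (2 + 2 * k) _ _ (subst₂ _≤_ (split-length k b)
            (trans (cong (λ z → z + z) (sym (m+[n∸m]≡n m≤h))) (split-halves k u)) N≤h+h)
  key : N * (2 + k) < 16 * c
  key = begin-strict
    N * (2 + k)                 <⟨ s≤s (m≤m+n _ _) ⟩
    suc (N * (2 + k) + _)       ≡⟨ expand-product k b ⟨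
    4 * suc k * (6 + 2 * k + b) ≤⟨ *-monoʳ-≤ (4 * suc k) slack ⟩
    4 * suc k * (2 * u)         ≡⟨ regroup k u ⟩
    8 * (suc k * u)             ≤⟨ *-monoʳ-≤ 8 busy ⟩
    8 * (2 * c)                 ≡⟨ *-assoc 8 2 c ⟨
    16 * c                      ∎
    where open ≤-Reasoning

-- Comparison histories

freshBelow : ℕ → List ℕ → ℕ
freshBelow zero    L = zero
freshBelow (suc m) L with m ∈? L
... | yes _ = freshBelow m (filter (λ y → ¬? (y ≟ m)) L)
... | no  _ = m

freshBelow-spec : ∀ m L → length L < m → freshBelow m L < m × freshBelow m L ∉ L
freshBelow-spec (suc m) L ∣L∣<m with m ∈? L
... | no  m∉L = ≤-refl , m∉L
... | yes m∈L =
  let L′ = filter (λ y → ¬? (y ≟ m)) L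
      v<m , v∉L′ = freshBelow-spec m L′
                     (≤-trans (filter-notAll _ L (Any.map (λ m≡y y≢m → y≢m (sym m≡y)) m∈L))
                              (m<1+n⇒m≤n ∣L∣<m))
  in m<n⇒m<1+n v<m , λ v∈L → v∉L′ (∈-filter⁺ _ v∈L (λ v≡m → <-irrefl v≡m v<m))

Comparison : Set
Comparison = ℕ × ℕ × Bool

History : Set
History = List Comparison

partner : ℕ → ℕ → ℕ → List ℕ
partner a b x with a ≟ x
... | yes _ = b ∷ []
... | no  _ = []

partners : History → ℕ → List ℕ
partners []                x = []
partners ((a , b , _) ∷ H) x = partner a b x ++ partner b a x ++ partners H x

degree : History → ℕ → ℕ
degree H x = length (partners H x)

length-partner-self : ∀ a b → length (partner a b a) ≡ 1
length-partner-self a b with a ≟ a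
... | yes _   = refl
... | no  a≢a = ⊥-elim (a≢a refl)

length-partner-other : ∀ a b {x} → a ≢ x → length (partner a b x) ≡ 0
length-partner-other a b {x} a≢x with a ≟ x
... | yes a≡x = ⊥-elim (a≢x a≡x)
... | no  _   = refl

degree-∷ : ∀ a b r H x →
  degree ((a , b , r) ∷ H) x ≡ length (partner a b x) + length (partner b a x) + degree H x
degree-∷ a b r H x = begin
  length (partner a b x ++ partner b a x ++ partners H x)
    ≡⟨ length-++ (partner a b x) ⟩
  length (partner a b x) + length (partner b a x ++ partners H x)
    ≡⟨ cong (length (partner a b x) +_) (length-++ (partner b a x)) ⟩
  length (partner a b x) + (length (partner b a x) + degree H x)
    ≡⟨ +-assoc (length (partner a b x)) _ _ ⟨
  length (partner a b x) + length (partner b a x) + degree H x ∎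
  where open ≡-Reasoning

sum-map-+ : ∀ (g h : ℕ → ℕ) xs → sum (map (λ x → g x + h x) xs) ≡ sum (map g xs) + sum (map h xs)
sum-map-+ g h []       = refl
sum-map-+ g h (x ∷ xs) = trans (cong (g x + h x +_) (sum-map-+ g h xs)) (interchange (g x) (h x) _ _)

sum-map-≥ : ∀ {c} (g : ℕ → ℕ) {xs} → All (λ x → c ≤ g x) xs → c * length xs ≤ sum (map g xs)
sum-map-≥ {c} g []            = ≤-reflexive (*-zeroʳ c)
sum-map-≥ {c} g {x ∷ xs} (c≤gx ∷ rest) =
  subst (_≤ sum (map g (x ∷ xs))) (sym (*-suc c (length xs))) (+-mono-≤ c≤gx (sum-map-≥ g rest))

sum-partner-absent : ∀ a b {xs} → All (a ≢_) xs → sum (map (λ x → length (partner a b x)) xs) ≡ 0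
sum-partner-absent a b []            = refl
sum-partner-absent a b (a≢x ∷ a∉xs)
  rewrite length-partner-other a b a≢x = sum-partner-absent a b a∉xs

sum-partner≤1 : ∀ a b {xs} → Unique xs → sum (map (λ x → length (partner a b x)) xs) ≤ 1
sum-partner≤1 a b []                       = z≤n
sum-partner≤1 a b {x ∷ xs} (x∉xs ∷ unique) with x ≟ a
... | yes refl rewrite length-partner-self a b | sum-partner-absent a b x∉xs = ≤-refl
... | no  x≢a  rewrite length-partner-other a b (x≢a ∘ sym) = sum-partner≤1 a b unique

sum-degree≤ : ∀ H {xs} → Unique xs → sum (map (degree H) xs) ≤ 2 * length H
sum-degree≤ []                {xs} _      = ≤-reflexive (sum-zero xs)
  where
  sum-zero : ∀ xs → sum (map (degree []) xs) ≡ 0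
  sum-zero []       = refl
  sum-zero (_ ∷ xs) = sum-zero xs
sum-degree≤ ((a , b , r) ∷ H) {xs} unique = begin
  sum (map (degree ((a , b , r) ∷ H)) xs)
    ≡⟨ cong sum (map-cong (degree-∷ a b r H) xs) ⟩
  sum (map (λ x → length (partner a b x) + length (partner b a x) + degree H x) xs)
    ≡⟨ sum-map-+ (λ x → length (partner a b x) + length (partner b a x)) (degree H) xs ⟩
  sum (map (λ x → length (partner a b x) + length (partner b a x)) xs) + sum (map (degree H) xs)
    ≡⟨ cong (_+ sum (map (degree H) xs)) (sum-map-+ _ _ xs) ⟩
  sum (map (λ x → length (partner a b x)) xs) + sum (map (λ x → length (partner b a x)) xs)
    + sum (map (degree H) xs)
    ≤⟨ +-mono-≤ (+-mono-≤ (sum-partner≤1 a b unique) (sum-partner≤1 b a unique)) (sum-degree≤ H unique) ⟩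
  2 + 2 * length H
    ≡⟨ *-suc 2 (length H) ⟨
  2 * length ((a , b , r) ∷ H) ∎
  where open ≤-Reasoning

degree-∷-left : ∀ {a b} r H → a ≢ b → degree ((a , b , r) ∷ H) a ≡ suc (degree H a)
degree-∷-left {a} {b} r H a≢b
  rewrite degree-∷ a b r H a | length-partner-self a b | length-partner-other b a (a≢b ∘ sym) = refl

degree-∷-right : ∀ {a b} r H → a ≢ b → degree ((a , b , r) ∷ H) b ≡ suc (degree H b)
degree-∷-right {a} {b} r H a≢b
  rewrite degree-∷ a b r H b | length-partner-self b a | length-partner-other a b a≢b = refl

degree-∷-other : ∀ {a b} r H {x} → x ≢ a → x ≢ b → degree ((a , b , r) ∷ H) x ≡ degree H x
degree-∷-other {a} {b} r H {x} x≢a x≢b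
  rewrite degree-∷ a b r H x | length-partner-other a b (x≢a ∘ sym) | length-partner-other b a (x≢b ∘ sym) = refl

degree-∷-≥ : ∀ c H x → degree H x ≤ degree (c ∷ H) x
degree-∷-≥ (a , b , r) H x rewrite degree-∷ a b r H x = m≤n+m (degree H x) _

true≢false : true ≢ false
true≢false ()

∈-partner-self : ∀ a b → b ∈ partner a b a
∈-partner-self a b with a ≟ a
... | yes _   = here refl
... | no  a≢a = ⊥-elim (a≢a refl)

∈-partnersˡ : ∀ {H a b r} → (a , b , r) ∈ H → b ∈ partners H a
∈-partnersˡ {(a′ , b′ , _) ∷ H} (here refl) = ∈-++⁺ˡ (∈-partner-self a′ b′)
∈-partnersˡ {(a′ , b′ , _) ∷ H} {a} (there c∈H) =
  ∈-++⁺ʳ (partner a′ b′ a) (∈-++⁺ʳ (partner b′ a′ a) (∈-partnersˡ c∈H))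

∈-partnersʳ : ∀ {H a b r} → (a , b , r) ∈ H → a ∈ partners H b
∈-partnersʳ {(a′ , b′ , _) ∷ H} (here refl) = ∈-++⁺ʳ (partner a′ b′ b′) (∈-++⁺ˡ (∈-partner-self b′ a′))
∈-partnersʳ {(a′ , b′ , _) ∷ H} {b = b} (there c∈H) =
  ∈-++⁺ʳ (partner a′ b′ b) (∈-++⁺ʳ (partner b′ a′ b) (∈-partnersʳ c∈H))

-- value is junk on blocks that are not committed.
record Assignment : Set where
  field
    committed : ℕ → Bool
    value     : ℕ → ℕ
open Assignment public

committed⇒≢open : ∀ {α x y} → committed α y ≡ true → committed α x ≡ false → y ≢ x
committed⇒≢open cy cx refl = true≢false (trans (sym cy) cx)

update : {A : Set} → (ℕ → A) → ℕ → A → ℕ → A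
update g x v y with y ≟ x
... | yes _ = v
... | no  _ = g y

update-≡ : ∀ {A : Set} (g : ℕ → A) x v → update g x v x ≡ v
update-≡ g x v with x ≟ x
... | yes _   = refl
... | no  x≢x = ⊥-elim (x≢x refl)

update-≢ : ∀ {A : Set} (g : ℕ → A) x v {y} → y ≢ x → update g x v y ≡ g y
update-≢ g x v {y} y≢x with y ≟ x
... | yes y≡x = ⊥-elim (y≢x y≡x)
... | no  _   = refl

Agrees : Assignment → ℕ → ℕ → Bool → Set
Agrees α a b true  = committed α a ≡ true × committed α b ≡ true × value α a ≡ value α b
Agrees α a b false = committed α a ≡ true → committed α b ≡ true → value α a ≢ value α b

Honest : Assignment → Comparison → Set
Honest α (a , b , r) = a ≢ b × Agrees α a b r

answer : Assignment → ℕ → ℕ → Bool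
answer α a b = committed α a ∧ committed α b ∧ isYes (value α a ≟ value α b)

answer-agrees : ∀ α a b → Agrees α a b (answer α a b)
answer-agrees α a b with committed α a in ca | committed α b in cb | value α a ≟ value α b
... | true  | true  | yes va≡vb = ca , cb , va≡vb
... | true  | true  | no  va≢vb = λ _ _ → va≢vb
... | true  | false | _         = λ _ cb′ → ⊥-elim (true≢false (trans (sym cb′) cb))
... | false | _     | _         = λ ca′ → ⊥-elim (true≢false (trans (sym ca′) ca))

Answers : (ℕ → ℕ) → Comparison → Set
Answers f (a , b , true)  = f a ≡ f b
Answers f (a , b , false) = f a ≢ f b

Consistent : (ℕ → ℕ) → History → Set
Consistent f = All (Answers f)

honest⇒answers : ∀ {α} → (∀ x → committed α x ≡ true) → ∀ {c} → Honest α c → Answers (value α) c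
honest⇒answers all-committed {_ , _ , true}  (_ , _ , _ , va≡vb) = va≡vb
honest⇒answers all-committed {a , b , false} (_ , agrees)       = agrees (all-committed a) (all-committed b)

bounded⇒atMostDistinct : ∀ {n σ} (T : Str n) → (∀ i → T i < σ) → AtMostDistinct σ T
bounded⇒atMostDistinct {σ = σ} T T<σ = upTo σ , ≤-reflexive (length-upTo σ) , λ i → ∈-upTo⁺ (T<σ i)

-- The adversary

-- The alphabet has σ = k + 2 symbols: committed blocks get symbols below
-- m = σ - 1, and m is kept for the rival string.
module Adversary (n k : ℕ) where

  m : ℕ
  m = suc k

  Free : ℕ → Set
  Free x = m ≤ x × x < ⌊ n /2⌋

  freshValue : History → ℕ → Assignment → ℕ
  freshValue H x α = freshBelow m (map (value α) (partners H x))

  commit : History → ℕ → Assignment → Assignment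
  commit H x α = record
    { committed = update (committed α) x true
    ; value     = update (value α) x (freshValue H x α)
    }

  record Valid (H : History) (α : Assignment) : Set where
    field
      value<m       : ∀ x → value α x < m
      open⇒free     : ∀ x → committed α x ≡ false → Free x
      open⇒degree≤k : ∀ x → committed α x ≡ false → degree H x ≤ k
      small-fixed   : ∀ v → v < m → value α v ≡ v
      honest        : All (Honest α) H
  open Valid public

  Saturated : History → Assignment → Set
  Saturated H α = ∀ x → Free x → committed α x ≡ true → m ≤ degree H x

  State : Set
  State = History × Assignment

  Invariant : State → Set
  Invariant (H , α) = Valid H α × Saturated H α

  free? : ∀ x → Dec (Free x)
  free? x = m ≤? x ×-dec x <? ⌊ n /2⌋

  -- Every block outside the free range starts committed, a block x < m to the
  -- symbol x; the modulus only keeps the other values below m.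
  initial : State
  initial = [] , record { committed = λ x → not (isYes (free? x)) ; value = _% m }

  initial-invariant : Invariant initial
  initial-invariant = valid , saturated
    where
    valid : Valid [] (proj₂ initial)
    valid = record
      { value<m       = λ x → m%n<n x m
      ; open⇒free     = open⇒free′
      ; open⇒degree≤k = λ _ _ → z≤n
      ; small-fixed   = λ _ → m<n⇒m%n≡m
      ; honest        = []
      }
      where
      open⇒free′ : ∀ x → not (isYes (free? x)) ≡ false → Free x
      open⇒free′ x ox with free? x
      ... | yes free-x = free-x
      ... | no  _      = ⊥-elim (true≢false ox)
    saturated : Saturated [] (proj₂ initial)
    saturated x free-x cx with free? x
    ... | yes _      = ⊥-elim (true≢false (sym cx))
    ... | no  ¬free  = ⊥-elim (¬free free-x)

  commit-open : ∀ H x α {y} → committed (commit H x α) y ≡ false → committed α y ≡ false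
  commit-open H x α {y} oy with y ≟ x
  ... | yes _ = ⊥-elim (true≢false oy)
  ... | no  _ = oy

  commit-committed : ∀ H x α {y} → committed α x ≡ false → committed α y ≡ true →
    committed (commit H x α) y ≡ true × value (commit H x α) y ≡ value α y
  commit-committed H x α ox cy = let y≢x = committed⇒≢open {α} cy ox in
    trans (update-≢ _ x true y≢x) cy , update-≢ _ x _ y≢x

  module _ {H : History} {α : Assignment} {x : ℕ} (valid : Valid H α) (open-x : committed α x ≡ false) where

    private
      α′ = commit H x α
      fresh-ok : freshValue H x α < m × freshValue H x α ∉ map (value α) (partners H x)
      fresh-ok = freshBelow-spec m _ (s≤s (subst (_≤ k) (sym (length-map (value α) (partners H x)))
                                                (open⇒degree≤k valid x open-x)))
      fresh∉ : ∀ {y} → value α y ≡ freshValue H x α → ¬ y ∈ partners H x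
      fresh∉ vy≡fresh y∈ = proj₂ fresh-ok (subst (_∈ _) vy≡fresh (∈-map⁺ (value α) y∈))


    commit-keeps-difference : ∀ {a b} → (a , b , false) ∈ H → a ≢ b →
      Agrees α a b false → Agrees α′ a b false
    commit-keeps-difference {a} {b} c∈H a≢b agrees ca′ cb′ with x ≟ a | x ≟ b
    ... | yes refl | yes refl = ⊥-elim (a≢b refl)
    ... | yes refl | no  x≢b  = λ va′≡vb′ → fresh∉ (begin
          value α b         ≡⟨ update-≢ _ x _ (x≢b ∘ sym) ⟨
          value α′ b        ≡⟨ va′≡vb′ ⟨
          value α′ x        ≡⟨ update-≡ _ x _ ⟩
          freshValue H x α  ∎) (∈-partnersˡ c∈H)
      where open ≡-Reasoning
    ... | no  x≢a  | yes refl = λ va′≡vb′ → fresh∉ (begin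
          value α a         ≡⟨ update-≢ _ x _ (x≢a ∘ sym) ⟨
          value α′ a        ≡⟨ va′≡vb′ ⟩
          value α′ x        ≡⟨ update-≡ _ x _ ⟩
          freshValue H x α  ∎) (∈-partnersʳ c∈H)
      where open ≡-Reasoning
    ... | no  x≢a  | no  x≢b  = λ va′≡vb′ → agrees
          (trans (sym (update-≢ _ x true (x≢a ∘ sym))) ca′)
          (trans (sym (update-≢ _ x true (x≢b ∘ sym))) cb′)
          (trans (sym (update-≢ _ x _ (x≢a ∘ sym))) (trans va′≡vb′ (update-≢ _ x _ (x≢b ∘ sym))))

    commit-honest : ∀ {c} → c ∈ H → Honest α c → Honest α′ c
    commit-honest {a , b , true} _ (a≢b , ca , cb , va≡vb) =
      let ca′ , va′ = commit-committed H x α open-x ca ; cb′ , vb′ = commit-committed H x α open-x cb in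
      a≢b , ca′ , cb′ , trans va′ (trans va≡vb (sym vb′))
    commit-honest {a , b , false} c∈H (a≢b , agrees) = a≢b , commit-keeps-difference c∈H a≢b agrees

    commit-valid : Valid H α′
    commit-valid = record
      { value<m       = value<m′
      ; open⇒free     = λ y → open⇒free valid y ∘ commit-open H x α
      ; open⇒degree≤k = λ y → open⇒degree≤k valid y ∘ commit-open H x α
      ; small-fixed   = λ v v<m → trans (update-≢ _ x _ (<⇒≢ (<-≤-trans v<m m≤x)))
                                        (small-fixed valid v v<m)
      ; honest        = All.tabulate (λ c∈H → commit-honest c∈H (All.lookup (honest valid) c∈H))
      }
      where
      m≤x : m ≤ x
      m≤x = proj₁ (open⇒free valid x open-x)
      value<m′ : ∀ y → value α′ y < m
      value<m′ y with y ≟ x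
      ... | yes _ = proj₁ fresh-ok
      ... | no  _ = value<m valid y

  -- A block is committed just before its (k + 1)-st comparison: it then has k
  -- partners, so some symbol below m differs from all of theirs.
  commitIfFull : History → ℕ → Assignment → Assignment
  commitIfFull H x α with committed α x | degree H x ≟ k
  ... | false | yes _ = commit H x α
  ... | _     | _     = α

  commitIfFull-valid : ∀ {H α} x → Valid H α → Valid H (commitIfFull H x α)
  commitIfFull-valid {H} {α} x valid with committed α x in ox | degree H x ≟ k
  ... | false | yes _ = commit-valid valid ox
  ... | false | no  _ = valid
  ... | true  | _     = valid

  commitIfFull-open : ∀ H y α {x} → committed (commitIfFull H y α) x ≡ false → committed α x ≡ false
  commitIfFull-open H y α ox with committed α y | degree H y ≟ k
  ... | false | yes _ = commit-open H y α ox
  ... | false | no  _ = ox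
  ... | true  | _     = ox

  commitIfFull-open-self : ∀ H y α → committed (commitIfFull H y α) y ≡ false → degree H y ≢ k
  commitIfFull-open-self H y α oy with committed α y in cy | degree H y ≟ k
  ... | false | yes _     = ⊥-elim (true≢false (trans (sym (update-≡ (committed α) y true)) oy))
  ... | false | no  d≢k   = d≢k
  ... | true  | _         = ⊥-elim (true≢false (trans (sym cy) oy))

  commitIfFull-committed : ∀ H y α {x} → committed (commitIfFull H y α) x ≡ true →
    committed α x ≡ true ⊎ (x ≡ y × degree H y ≡ k)
  commitIfFull-committed H y α {x} cx with committed α y | degree H y ≟ k
  ... | true  | _       = inj₁ cx
  ... | false | no  _   = inj₁ cx
  ... | false | yes d≡k with x ≟ y
  ...   | yes x≡y = inj₂ (x≡y , d≡k)
  ...   | no  _   = inj₁ cx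

  module _ {H : History} {α : Assignment} {a b : ℕ} (a≢b : a ≢ b) (valid : Valid H α) where

    private
      α₁ = commitIfFull H a α
      α₂ = commitIfFull H b α₁
      r  = answer α₂ a b
      valid₁ = commitIfFull-valid a valid
      valid₂ = commitIfFull-valid b valid₁

    record-open-degree : ∀ x → committed α₂ x ≡ false → degree ((a , b , r) ∷ H) x ≤ k
    record-open-degree x ox with x ≟ a | x ≟ b
    ... | yes refl | yes refl = ⊥-elim (a≢b refl)
    ... | yes refl | no  _    = let oa₁ = commitIfFull-open H b α₁ ox in
      subst (_≤ k) (sym (degree-∷-left r H a≢b))
        (≤∧≢⇒< (open⇒degree≤k valid a (commitIfFull-open H a α oa₁)) (commitIfFull-open-self H a α oa₁))
    ... | no  _    | yes refl =
      subst (_≤ k) (sym (degree-∷-right r H a≢b))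
        (≤∧≢⇒< (open⇒degree≤k valid₁ b (commitIfFull-open H b α₁ ox)) (commitIfFull-open-self H b α₁ ox))
    ... | no  x≢a  | no  x≢b  =
      subst (_≤ k) (sym (degree-∷-other r H x≢a x≢b)) (open⇒degree≤k valid₂ x ox)

    record-valid : Valid ((a , b , r) ∷ H) α₂
    record-valid = record
      { value<m       = value<m valid₂
      ; open⇒free     = open⇒free valid₂
      ; open⇒degree≤k = record-open-degree
      ; small-fixed   = small-fixed valid₂
      ; honest        = (a≢b , answer-agrees α₂ a b) ∷ honest valid₂
      }

    record-saturated : Saturated H α → Saturated ((a , b , r) ∷ H) α₂
    record-saturated saturated x free-x cx with commitIfFull-committed H b α₁ cx
    ... | inj₂ (refl , d≡k) = ≤-reflexive (sym (trans (degree-∷-right r H a≢b) (cong suc d≡k)))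
    ... | inj₁ cx₁ with commitIfFull-committed H a α cx₁
    ...   | inj₂ (refl , d≡k) = ≤-reflexive (sym (trans (degree-∷-left r H a≢b) (cong suc d≡k)))
    ...   | inj₁ cx₀          = ≤-trans (saturated x free-x cx₀) (degree-∷-≥ (a , b , r) H x)

  respond : ℕ → ℕ → State → Bool × State
  respond a b (H , α) with a ≟ b
  ... | yes _ = true , H , α
  ... | no  _ = let α′ = commitIfFull H b (commitIfFull H a α) in
                answer α′ a b , (a , b , answer α′ a b) ∷ H , α′

  respond-answers : ∀ a b S {r S′ f} → respond a b S ≡ (r , S′) → Consistent f (proj₁ S′) →
    Answers f (a , b , r)
  respond-answers a b (H , α) eq cons with a ≟ b
  respond-answers a b (H , α) refl cons       | yes refl = refl
  respond-answers a b (H , α) refl (ans ∷ _) | no  _    = ans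

  respond-grows : ∀ a b S {r S′} → respond a b S ≡ (r , S′) → proj₁ S ⊆ proj₁ S′
  respond-grows a b (H , α) eq with a ≟ b
  respond-grows a b (H , α) refl | yes _ = id
  respond-grows a b (H , α) refl | no  _ = there

  respond-invariant : ∀ a b S {r S′} → respond a b S ≡ (r , S′) → Invariant S →
    Invariant S′ × length (proj₁ S′) ≤ suc (length (proj₁ S))
  respond-invariant a b (H , α) eq inv with a ≟ b
  respond-invariant a b (H , α) refl inv                   | yes _   = inv , n≤1+n _
  respond-invariant a b (H , α) refl (valid , saturated) | no  a≢b =
    (record-valid a≢b valid , record-saturated a≢b valid saturated) , ≤-refl

  record Outcome : Set where
    constructor outcome
    field
      output      : List ℕ
      final       : State
      comparisons : ℕ
  open Outcome public

  tick : Outcome → Outcome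
  tick o = record o { comparisons = suc (comparisons o) }

  block : Fin n → ℕ
  block i = ⌊ toℕ i /2⌋

  blockString : (ℕ → ℕ) → Str n
  blockString f = f ∘ block

  mutual
    play : DTree n → State → Outcome
    play (leaf o)        S = outcome o S 0
    play (query i j l r) S = tick (continue (respond (block i) (block j) S) l r)

    continue : Bool × State → DTree n → DTree n → Outcome
    continue (true  , S) l r = play l S
    continue (false , S) l r = play r S

  play-grows : ∀ t S → proj₁ S ⊆ proj₁ (final (play t S))
  play-grows (leaf o)        S = id
  play-grows (query i j l r) S with respond (block i) (block j) S in eq
  ... | true  , S′ = play-grows l S′ ∘ respond-grows _ _ S eq
  ... | false , S′ = play-grows r S′ ∘ respond-grows _ _ S eq

  play-correct : ∀ t S f → Consistent f (proj₁ (final (play t S))) →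
    run t (blockString f) ≡ output (play t S) × cost t (blockString f) ≡ comparisons (play t S)
  play-correct (leaf o)        S f cons = refl , refl
  play-correct (query i j l r) S f cons with respond (block i) (block j) S in eq
  ... | true , S′ with f (block i) ≟ f (block j)
  ...   | yes _    = map₂ (cong suc) (play-correct l S′ f cons)
  ...   | no  fi≢fj = ⊥-elim (fi≢fj (respond-answers _ _ S eq (anti-mono (play-grows l S′) cons)))
  play-correct (query i j l r) S f cons | false , S′ with f (block i) ≟ f (block j)
  ...   | yes fi≡fj = ⊥-elim (respond-answers _ _ S eq (anti-mono (play-grows r S′) cons) fi≡fj)
  ...   | no  _    = map₂ (cong suc) (play-correct r S′ f cons)

  play-invariant : ∀ t S → Invariant S →
    Invariant (final (play t S)) × length (proj₁ (final (play t S))) ≤ length (proj₁ S) + comparisons (play t S)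
  play-invariant (leaf o)        S inv = inv , m≤m+n _ 0
  play-invariant (query i j l r) S inv with respond (block i) (block j) S in eq
  ... | true  , S′ = let inv′ , len′ = respond-invariant _ _ S eq inv
                         inv″ , len″ = play-invariant l S′ inv′
                     in inv″ , ≤+suc len″ len′
  ... | false , S′ = let inv′ , len′ = respond-invariant _ _ S eq inv
                         inv″ , len″ = play-invariant r S′ inv′
                     in inv″ , ≤+suc len″ len′

  freeBlocks : List ℕ
  freeBlocks = applyUpTo (m +_) (⌊ n /2⌋ ∸ m)

  free⇒∈freeBlocks : ∀ {x} → Free x → x ∈ freeBlocks
  free⇒∈freeBlocks {x} (m≤x , x<h) =
    subst (_∈ freeBlocks) (m+[n∸m]≡n m≤x) (∈-applyUpTo⁺ (m +_) (∸-monoˡ-< x<h m≤x))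

  ∈freeBlocks⇒free : ∀ {x} → x ∈ freeBlocks → Free x
  ∈freeBlocks⇒free x∈ with ∈-applyUpTo⁻ (m +_) x∈
  ... | i , i<h∸m , refl =
    let m<h = m∸n≢0⇒n<m (λ h∸m≡0 → <⇒≢ (<-≤-trans z<s i<h∸m) (sym h∸m≡0)) in
    m≤m+n m i , subst (m + i <_) (m+[n∸m]≡n {m} (<⇒≤ m<h)) (+-monoʳ-< m i<h∸m)

  freeBlocks-unique : Unique freeBlocks
  freeBlocks-unique = applyUpTo⁺₁ (m +_) _ (λ i<j _ → <⇒≢ i<j ∘ +-cancelˡ-≡ m _ _)

  commitIfOpen : History → ℕ → Assignment → Assignment
  commitIfOpen H x α = if committed α x then α else commit H x α

  commitIfOpen-valid : ∀ {H α} x → Valid H α → Valid H (commitIfOpen H x α)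
  commitIfOpen-valid {α = α} x valid with committed α x in cx
  ... | true  = valid
  ... | false = commit-valid valid cx

  commitIfOpen-committed : ∀ H x α {y} → committed α y ≡ true → committed (commitIfOpen H x α) y ≡ true
  commitIfOpen-committed H x α cy with committed α x in cx
  ... | true  = cy
  ... | false = proj₁ (commit-committed H x α cx cy)

  commitIfOpen-self : ∀ H x α → committed (commitIfOpen H x α) x ≡ true
  commitIfOpen-self H x α with committed α x in cx
  ... | true  = cx
  ... | false = update-≡ (committed α) x true

  commitAll : History → List ℕ → Assignment → Assignment
  commitAll H []       α = α
  commitAll H (x ∷ xs) α = commitAll H xs (commitIfOpen H x α)

  commitAll-valid : ∀ {H α} xs → Valid H α → Valid H (commitAll H xs α)
  commitAll-valid []       valid = valid
  commitAll-valid (x ∷ xs) valid = commitAll-valid xs (commitIfOpen-valid x valid)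

  commitAll-committed : ∀ H xs α {y} → committed α y ≡ true → committed (commitAll H xs α) y ≡ true
  commitAll-committed H []       α cy = cy
  commitAll-committed H (x ∷ xs) α cy = commitAll-committed H xs _ (commitIfOpen-committed H x α cy)

  commitAll-∈ : ∀ H xs α {y} → y ∈ xs → committed (commitAll H xs α) y ≡ true
  commitAll-∈ H (x ∷ xs) α (here refl) = commitAll-committed H xs _ (commitIfOpen-self H x α)
  commitAll-∈ H (x ∷ xs) α (there y∈)  = commitAll-∈ H xs _ y∈

  finalize : History → Assignment → Assignment
  finalize H = commitAll H freeBlocks

  finalize-valid : ∀ {H α} → Valid H α → Valid H (finalize H α)
  finalize-valid = commitAll-valid freeBlocks

  finalize-committed : ∀ {H α} → Valid H α → ∀ x → committed (finalize H α) x ≡ true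
  finalize-committed {H} {α} valid x with committed (finalize H α) x in cx
  ... | true  = refl
  ... | false = ⊥-elim (true≢false (trans (sym (commitAll-∈ H freeBlocks α
                  (free⇒∈freeBlocks (open⇒free (finalize-valid valid) x cx)))) cx))

  finalize-consistent : ∀ {H α} → Valid H α → Consistent (value (finalize H α)) H
  finalize-consistent valid =
    All.map (honest⇒answers (finalize-committed valid)) (honest (finalize-valid valid))

  saturated⇒busy : ∀ {H α} → Saturated H α → All (λ x → committed α x ≡ true) freeBlocks →
    m * (⌊ n /2⌋ ∸ m) ≤ 2 * length H
  saturated⇒busy {H} saturated all-committed = begin
    m * (⌊ n /2⌋ ∸ m)                ≡⟨ cong (m *_) (length-applyUpTo (m +_) _) ⟨
    m * length freeBlocks            ≤⟨ sum-map-≥ (degree H) (All.tabulate λ x∈ →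
                                          saturated _ (∈freeBlocks⇒free x∈) (All.lookup all-committed x∈)) ⟩
    sum (map (degree H) freeBlocks)  ≤⟨ sum-degree≤ H freeBlocks-unique ⟩
    2 * length H                     ∎
    where open ≤-Reasoning

  blockString-atMostDistinct : ∀ {σ} f → (∀ x → f x < σ) → AtMostDistinct σ (blockString f)
  blockString-atMostDistinct f f<σ = bounded⇒atMostDistinct (blockString f) (f<σ ∘ block)

  module Against (t : DTree n) where

    H : History
    H = proj₁ (final (play t initial))

    α : Assignment
    α = proj₂ (final (play t initial))

    valid : Valid H α
    valid = proj₁ (proj₁ (play-invariant t initial initial-invariant))

    completion : ℕ → ℕ
    completion = value (finalize H α)

    completion<m : ∀ x → completion x < m
    completion<m = value<m (finalize-valid valid)

    cost-completion : cost t (blockString completion) ≡ comparisons (play t initial)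
    cost-completion = proj₂ (play-correct t initial completion (finalize-consistent valid))

    all-committed⇒busy : All (λ x → committed α x ≡ true) freeBlocks →
      m * (⌊ n /2⌋ ∸ m) ≤ 2 * comparisons (play t initial)
    all-committed⇒busy all-committed =
      let (_ , saturated) , ∣H∣≤c = play-invariant t initial initial-invariant in
      ≤-trans (saturated⇒busy {H} {α} saturated all-committed) (*-monoʳ-≤ 2 ∣H∣≤c)

    module Fooling {p : ℕ} (open-p : committed α p ≡ false) where

      rival : ℕ → ℕ
      rival = update completion p m

      rival≤m : ∀ x → rival x ≤ m
      rival≤m x with x ≟ p
      ... | yes _ = ≤-refl
      ... | no  _ = <⇒≤ (completion<m x)

      private
        m≤p : m ≤ p
        m≤p = proj₁ (open⇒free valid p open-p)

        p<h : p < ⌊ n /2⌋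
        p<h = proj₂ (open⇒free valid p open-p)

        rival-answers : ∀ {c} → Honest α c → Answers completion c → Answers rival c
        rival-answers {a , b , true} (_ , ca , cb , _) fa≡fb =
          trans (update-≢ completion p m (committed⇒≢open {α} ca open-p))
            (trans fa≡fb (sym (update-≢ completion p m (committed⇒≢open {α} cb open-p))))
        rival-answers {a , b , false} (a≢b , _) fa≢fb with p ≟ a | p ≟ b
        ... | yes refl | yes refl = ⊥-elim (a≢b refl)
        ... | yes refl | no  p≢b  = λ gp≡gb → <-irrefl
              (trans (sym (update-≢ completion p m (p≢b ∘ sym))) (trans (sym gp≡gb) (update-≡ completion p m)))
              (completion<m b)
        ... | no  p≢a  | yes refl = λ ga≡gp → <-irrefl
              (trans (sym (update-≢ completion p m (p≢a ∘ sym))) (trans ga≡gp (update-≡ completion p m)))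
              (completion<m a)
        ... | no  p≢a  | no  p≢b  = λ ga≡gb → fa≢fb
              (trans (sym (update-≢ completion p m (p≢a ∘ sym))) (trans ga≡gb (update-≢ completion p m (p≢b ∘ sym))))

      same-output : run t (blockString rival) ≡ run t (blockString completion)
      same-output =
        trans (proj₁ (play-correct t initial rival rival-consistent))
              (sym (proj₁ (play-correct t initial completion (finalize-consistent valid))))
        where
        rival-consistent : Consistent rival H
        rival-consistent = All.zipWith (λ (h , a) → rival-answers h a) (honest valid , finalize-consistent valid)

      repeated : OccursTwice (toList (blockString completion)) (p + p) 2
      repeated = occursTwice-tabulateℕ n (completion ∘ ⌊_/2⌋) (+-mono-< v<p v<p) (block-fits p<h)
        (trans (cong completion (⌊n+n/2⌋≡n v)) (trans fv≡v (sym (cong completion (⌊n+n/2⌋≡n p)))))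
        (trans (cong completion (⌊1+n+n/2⌋≡n v)) (trans fv≡v (sym (cong completion (⌊1+n+n/2⌋≡n p)))))
        where
        v = completion p
        v<p : v < p
        v<p = <-≤-trans (completion<m p) m≤p
        fv≡v : completion v ≡ v
        fv≡v = small-fixed (finalize-valid valid) v (completion<m p)

      new : NewSymbol (toList (blockString rival)) (p + p)
      new = newSymbol-tabulateℕ n (rival ∘ ⌊_/2⌋) (<-≤-trans (m<m+n (p + p) z<s) (block-fits p<h))
        λ j j<p+p gj≡gp → let ⌊j/2⌋<p = m<n+n⇒⌊m/2⌋<n j<p+p in <-irrefl
          (trans (sym (update-≢ completion p m (<⇒≢ ⌊j/2⌋<p)))
                 (trans gj≡gp (trans (cong rival (⌊n+n/2⌋≡n p)) (update-≡ completion p m))))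
          (completion<m ⌊ j /2⌋)

corollary10 : (n σ : ℕ) → 2 ≤ σ → 4 * σ < n →
    ¬ (Σ (DTree n) λ t → (T : Str n) → AtMostDistinct σ T →
    (16 * cost t T ≤ (n ∸ 1) * σ) × IsFFactorisation (toList T) (run t T))
corollary10 n .(suc (suc k)) (s≤s (s≤s {n = k} _)) 4σ<n (t , solves) =
  case all? (λ x → committed α x ≟ᵇ true) freeBlocks of λ where
    (yes all-committed) →
      too-few-comparisons n k (comparisons (play t initial)) 4σ<n (all-committed⇒busy all-committed)
      (subst (λ c → 16 * c ≤ _) cost-completion (proj₁ (solves _ completion-ok)))
    (no some-open) →
      let _ , _ , open-p = find (¬All⇒Any¬ (λ x → committed α x ≟ᵇ true) _ some-open)
          open Fooling (¬-not open-p)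
      in fFactorisation-detects-repeat repeated new (proj₂ (solves _ completion-ok))
           (subst (IsFFactorisation _) same-output
             (proj₂ (solves _ (blockString-atMostDistinct rival (s≤s ∘ rival≤m)))))
  where
  open Adversary n k
  open Against t
  completion-ok : AtMostDistinct (suc (suc k)) (blockString completion)
  completion-ok = blockString-atMostDistinct completion (m<n⇒m<1+n ∘ completion<m)
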